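{- Let $k$ be a positive integer and let $\mathcal{H}$ be a connected hypergraph with hypertree depth at most $k$. Then for no $n\ge 2^{k+1}$ is there a hypergraph homomorphism $(h_V,h_E)$ from $\mathcal{H}$ to $\mathcal{P}_n$ with both $h_V$ and $h_E$ surjective.
   Context: A hypergraph is $(V,E,\beta)$ with disjoint finite $V,E$ and total $\beta\colon E\to\mathcal{P}(V)$ with $V=\bigcup_e\beta(e)$; it is connected if its incidence graph (bipartite graph on $V\cup E$ with $e$ adjacent to $v$ iff $v\in\beta(e)$) is connected. $\mathcal{P}_n$ has vertices $\{1,\dots,n+1\}$, hyperedges $e_1,\dots,e_n$, $\beta(e_i)=\{i,i+1\}$. A homomorphism $\mathcal{F}\to\mathcal{G}$ is a pair $(h_V,h_E)$ with $h_V(\beta_{\mathcal{F}}(e))=\beta_{\mathcal{G}}(h_E(e))$ for all hyperedges $e$. Hypertree depth: for a rooted forest $F$, $\le_F$ is the tree order (roots minimal), $P(s,t)$ the node set of the path from $s$ to $t$ (empty if none), $P(s)$ the path from $s$ to its root, $\mathrm{lcv}(s,t)$ the $\le_F$-maximum of $P(s)\cap P(t)$ (defined iff same tree), height the maximum $|P(s)|$. An elimination forest of $\mathcal{H}$ is $(F,\Gamma)$, $\Gamma\colon V(F)\to E(\mathcal{H})$, such that with $\hat\Gamma(t)=\beta(\Gamma(t))$: (1) every vertex lies in some $\hat\Gamma(t)$; (2) for each hyperedge $e$ there are $s\le_F t$ with $\beta(e)\subseteq\bigcup_{p\in P(s,t)}\hat\Gamma(p)$; (3) if $\hat\Gamma(s)\cap\hat\Gamma(t)\ne\emptyset$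 then $\mathrm{lcv}(s,t)$ is defined and $\hat\Gamma(s)\cap\hat\Gamma(t)\subseteq\bigcup_{p\in P(\mathrm{lcv}(s,t))}\hat\Gamma(p)$. The hypertree depth is the minimum height of an elimination forest. -}

module Defs where

open import Data.Nat using (ℕ; zero; suc; _≤_; _^_; _+_)
open import Data.Fin using (Fin; _<_; inject₁) renaming (suc to fsuc)
open import Data.Fin.Subset using (Subset; _∈_)
open import Data.Maybe using (Maybe; just; nothing)
open import Data.Sum using (_⊎_; inj₁; inj₂)
open import Data.Product using (Σ; ∃; _×_; _,_)
open import Relation.Binary.PropositionalEquality using (_≡_)
open import Relation.Binary.Construct.Closure.ReflexiveTransitive using (Star)
open import Function using (Surjective)

-- Hypergraphs: V = Fin nV, E = Fin nE (disjoint by construction, as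
-- they are kept apart by _⊎_ wherever they are mixed), β : E → P(V),
-- and V = ⋃ β(e).

record Hypergraph : Set where
  field
    nV     : ℕ
    nE     : ℕ
    β      : Fin nE → Subset nV
    covers : ∀ (v : Fin nV) → ∃ λ (e : Fin nE) → v ∈ β e

open Hypergraph public

data IncAdj (H : Hypergraph) : Fin (nV H) ⊎ Fin (nE H) → Fin (nV H) ⊎ Fin (nE H) → Set where
  ve : ∀ {v e} → v ∈ β H e → IncAdj H (inj₁ v) (inj₂ e)
  ev : ∀ {v e} → v ∈ β H e → IncAdj H (inj₂ e) (inj₁ v)

Connected : Hypergraph → Set
Connected H = ∀ x y → Star (IncAdj H) x y

-- The path hypergraph P_n: vertices 1..n+1 are Fin (suc n) (shifted by
-- one), hyperedges e_1..e_n are Fin n, β(e_i) = {i, i+1}.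

βP : ∀ n → Fin n → Fin (suc n) → Set
βP n i w = (w ≡ inject₁ i) ⊎ (w ≡ fsuc i)

record HomToPath (H : Hypergraph) (n : ℕ) : Set where
  field
    hV : Fin (nV H) → Fin (suc n)
    hE : Fin (nE H) → Fin n
    image⊆ : ∀ e v → v ∈ β H e → βP n (hE e) (hV v)
    image⊇ : ∀ e w → βP n (hE e) w → ∃ λ v → v ∈ β H e × hV v ≡ w

-- To
-- guarantee acyclicity, a parent has a smaller index than its child
-- (every finite rooted forest is isomorphic to one of this form).

record RootedForest : Set where
  field
    m        : ℕ
    parent   : Fin m → Maybe (Fin m)
    parent<  : ∀ {s t} → parent t ≡ just s → s < t

open RootedForest public

data Anc (F : RootedForest) : Fin (m F) → Fin (m F) → Set where
  anc-refl : ∀ {t} → Anc F t t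
  anc-step : ∀ {s p t} → parent F t ≡ just p → Anc F s p → Anc F s t

data HasDepth (F : RootedForest) : Fin (m F) → ℕ → Set where
  dep-root : ∀ {t} → parent F t ≡ nothing → HasDepth F t 1
  dep-step : ∀ {t p d} → parent F t ≡ just p → HasDepth F p d → HasDepth F t (suc d)

HeightAtMost : RootedForest → ℕ → Set
HeightAtMost F k = ∀ t d → HasDepth F t d → d ≤ k

IsLcv : (F : RootedForest) → Fin (m F) → Fin (m F) → Fin (m F) → Set
IsLcv F s t l = Anc F l s × Anc F l t × (∀ p → Anc F p s → Anc F p t → Anc F p l)

record EliminationForest (H : Hypergraph) : Set where
  field
    forest : RootedForest
    Γ      : Fin (m forest) → Fin (nE H)
    cond1  : ∀ v → ∃ λ t → v ∈ β H (Γ t)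
    cond2  : ∀ e → Σ (Fin (m forest)) λ s → Σ (Fin (m forest)) λ t →
               Anc forest s t ×
               (∀ v → v ∈ β H e →
                  ∃ λ p → Anc forest s p × Anc forest p t × v ∈ β H (Γ p))
    cond3  : ∀ s t v → v ∈ β H (Γ s) → v ∈ β H (Γ t) →
               ∃ λ l → IsLcv forest s t l ×
                 (∀ w → w ∈ β H (Γ s) → w ∈ β H (Γ t) →
                    ∃ λ p → Anc forest p l × w ∈ β H (Γ p))

HypertreeDepthAtMost : Hypergraph → ℕ → Set
HypertreeDepthAtMost H k =
  Σ (EliminationForest H) λ EF → HeightAtMost (EliminationForest.forest EF) k

module Submission where

-- Let τ v be the topmost node of the elimination forest whose bag contains v; condition (2) makes
-- τ u and τ w comparable whenever u and w share a hyperedge.  Call u and w linked if moreover their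
-- images in P_n differ by at most one; connectivity then yields a linked walk from a preimage of the
-- last vertex of P_n to a preimage of the first.  By induction on h, a linked walk inside the subtree
-- of a node t of height h changes the image by at most 2^(h+1) − 3: either it stays inside the
-- subtree of one child of t, or both of its ends are joined, within child subtrees, to vertices of
-- the bag of t, whose images lie on the edge h_E(Γ t).  Hence n ≤ 2^(k+1) − 3.

open import Defs
open import Data.Nat using (ℕ; _≤_; _^_; _+_)
open import Data.Fin using (Fin)
open import Data.Product using (Σ; _×_)
open import Function using (Surjective)
open import Relation.Binary.PropositionalEquality using (_≡_)
open import Relation.Nullary using (¬_)

open import Data.Nat using (zero; suc; _*_; _<_; s≤s; z<s)
open import Data.Nat.Properties
open import Data.Nat.Tactic.RingSolver using (solve-∀)
open import Data.Fin as Fin using (toℕ; fromℕ; fromℕ<; inject) renaming (zero to fzero)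
open import Data.Fin.Properties using (toℕ-inject₁; toℕ-fromℕ; toℕ-fromℕ<; toℕ-inject; toℕ-injective; ¬∀⟶∃¬-smallest)
open import Data.Fin.Induction using (<-wellFounded)
open import Data.Fin.Subset using (Subset; _∈_; _∉_)
open import Data.Fin.Subset.Properties using (_∈?_)
open import Data.Maybe using (just; nothing)
open import Data.Maybe.Properties using (just-injective)
open import Data.Sum using (_⊎_; inj₁; inj₂)
open import Data.Product using (_,_; proj₁; proj₂; ∃; ∃₂)
open import Data.Empty using (⊥-elim)
open import Relation.Nullary using (yes; no; ¬?)
open import Relation.Nullary.Decidable using (decidable-stable)
open import Relation.Binary.PropositionalEquality using (refl; sym; trans; cong; subst; subst₂; _≢_)
open import Relation.Binary.Construct.Closure.ReflexiveTransitive using (Star; ε; _◅_; reverse)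
open import Induction.WellFounded using (Acc; acc)

module ForestOrder (F : RootedForest) where

  Node : Set
  Node = Fin (m F)

  infix 4 _≼_
  _≼_ : Node → Node → Set
  _≼_ = Anc F

  IsRoot : Node → Set
  IsRoot r = parent F r ≡ nothing

  Comparable : Node → Node → Set
  Comparable p q = p ≼ q ⊎ q ≼ p

  ≼-trans : ∀ {p q t} → p ≼ q → q ≼ t → p ≼ t
  ≼-trans p≼q anc-refl          = p≼q
  ≼-trans p≼q (anc-step e q≼t′) = anc-step e (≼-trans p≼q q≼t′)

  ≼⇒≡⊎< : ∀ {p t} → p ≼ t → p ≡ t ⊎ p Fin.< t
  ≼⇒≡⊎< anc-refl = inj₁ refl
  ≼⇒≡⊎< (anc-step e p≼q) with ≼⇒≡⊎< p≼q
  ... | inj₁ refl = inj₂ (parent< F e)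
  ... | inj₂ p<q  = inj₂ (<-trans p<q (parent< F e))

  ≼-antisym : ∀ {p q} → p ≼ q → q ≼ p → p ≡ q
  ≼-antisym p≼q q≼p with ≼⇒≡⊎< p≼q | ≼⇒≡⊎< q≼p
  ... | inj₁ p≡q | _         = p≡q
  ... | inj₂ _   | inj₁ q≡p  = sym q≡p
  ... | inj₂ p<q | inj₂ q<p  = ⊥-elim (<-asym p<q q<p)

  ancestors-comparable : ∀ {p q t} → p ≼ t → q ≼ t → Comparable p q
  ancestors-comparable anc-refl q≼t = inj₂ q≼t
  ancestors-comparable p≼t@(anc-step _ _) anc-refl = inj₁ p≼t
  ancestors-comparable (anc-step e p≼s) (anc-step e′ q≼s′)
    with just-injective (trans (sym e) e′)
  ... | refl = ancestors-comparable p≼s q≼s′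

  ∃-root-≼ : ∀ t → ∃ λ r → IsRoot r × r ≼ t
  ∃-root-≼ t = go t (<-wellFounded t)
    where
    go : ∀ t → Acc Fin._<_ t → ∃ λ r → IsRoot r × r ≼ t
    go t (acc rec) with parent F t in e
    ... | nothing = t , e , anc-refl
    ... | just p with go p (rec (parent< F e))
    ...   | r , root , r≼p = r , root , anc-step e r≼p

  child-toward : ∀ {t p} → t ≼ p → p ≢ t → ∃ λ c → parent F c ≡ just t × c ≼ p
  child-toward anc-refl p≢t = ⊥-elim (p≢t refl)
  child-toward {t} (anc-step {p = q} e t≼q) p≢t with q Fin.≟ t
  ... | yes refl = _ , e , anc-refl
  ... | no q≢t with child-toward t≼q q≢t
  ...   | c , pc , c≼q = c , pc , anc-step e c≼q

  comparable-subtree : ∀ {p q c} → Comparable p q → c ≼ q →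
                       c ≼ p ⊎ ∃ λ d → parent F c ≡ just d × p ≼ d
  comparable-subtree (inj₂ q≼p) c≼q = inj₁ (≼-trans c≼q q≼p)
  comparable-subtree (inj₁ p≼q) c≼q with ancestors-comparable c≼q p≼q
  ... | inj₁ c≼p              = inj₁ c≼p
  ... | inj₂ anc-refl         = inj₁ anc-refl
  ... | inj₂ (anc-step e p≼d) = inj₂ (_ , e , p≼d)

  comparable-below-root : ∀ {p q r} → IsRoot r → r ≼ p → Comparable p q → r ≼ q
  comparable-below-root root r≼p (inj₁ p≼q) = ≼-trans r≼p p≼q
  comparable-below-root root r≼p (inj₂ q≼p) with comparable-subtree (inj₁ q≼p) r≼p
  ... | inj₁ r≼q             = r≼q
  ... | inj₂ (_ , e , _) with trans (sym root) e
  ...   | ()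

  comparable-below-child : ∀ {p q t c} → parent F c ≡ just t → t ≼ p → p ≢ t →
                           Comparable p q → c ≼ q → c ≼ p
  comparable-below-child pc t≼p p≢t p~q c≼q with comparable-subtree p~q c≼q
  ... | inj₁ c≼p = c≼p
  ... | inj₂ (d , e , p≼d) with just-injective (trans (sym pc) e)
  ...   | refl = ⊥-elim (p≢t (≼-antisym p≼d t≼p))

module TopNode (H : Hypergraph) (EF : EliminationForest H) where
  open EliminationForest EF
  open ForestOrder forest

  bag : Node → Subset (nV H)
  bag t = β H (Γ t)

  private
    least-bag : ∀ v → ∃ λ t → ¬ v ∉ bag t × ((j : Fin (toℕ t)) → v ∉ bag (inject j))
    least-bag v = ¬∀⟶∃¬-smallest _ (λ t → v ∉ bag t) (λ t → ¬? (v ∈? bag t))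
                    λ v∉all → v∉all _ (proj₂ (cond1 v))

  τ : Fin (nV H) → Node
  τ v = proj₁ (least-bag v)

  τ-mem : ∀ v → v ∈ bag (τ v)
  τ-mem v = decidable-stable (v ∈? bag (τ v)) (proj₁ (proj₂ (least-bag v)))

  τ-least : ∀ {v p} → p Fin.< τ v → v ∉ bag p
  τ-least {v} {p} p<τ = subst (λ q → v ∉ bag q) inject-j≡p (proj₂ (proj₂ (least-bag v)) j)
    where
    j = fromℕ< p<τ
    inject-j≡p : inject j ≡ p
    inject-j≡p = toℕ-injective (trans (toℕ-inject j) (toℕ-fromℕ< p<τ))

  -- Condition (3) for τ v and s puts a bag containing v above lcv(τ v, s); as ancestors have smaller
  -- indices, that bag is τ v itself.
  τ-≼ : ∀ {v s} → v ∈ bag s → τ v ≼ s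
  τ-≼ {v} {s} v∈s with cond3 (τ v) s v (τ-mem v) v∈s
  ... | l , (l≼τ , l≼s , _) , common with common v (τ-mem v) v∈s
  ...   | p , p≼l , v∈p with ≼⇒≡⊎< (≼-trans p≼l l≼τ)
  ...     | inj₁ refl = ≼-trans p≼l l≼s
  ...     | inj₂ p<τ  = ⊥-elim (τ-least p<τ v∈p)

  τ-comparable : ∀ {e u w} → u ∈ β H e → w ∈ β H e → Comparable (τ u) (τ w)
  τ-comparable {e} u∈e w∈e with cond2 e
  ... | _ , _ , _ , covered with covered _ u∈e | covered _ w∈e
  ...   | p , _ , p≼t , u∈p | q , _ , q≼t , w∈q =
          ancestors-comparable (≼-trans (τ-≼ u∈p) p≼t) (≼-trans (τ-≼ w∈q) q≼t)

OnEdge : ℕ → ℕ → Set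
OnEdge y a = a ≤ y × y ≤ suc a

-- Near P a y: y is within P - 3/2 of a + 1/2, the midpoint of the edge {a, a + 1}.
Near : ℕ → ℕ → ℕ → Set
Near P a y = suc y ≤ a + P × 2 + a ≤ y + P

onEdge⇒near : ∀ {P a y} → 2 ≤ P → OnEdge y a → Near P a y
onEdge⇒near {P} {a} {y} 2≤P (a≤y , y≤1+a) =
  ≤-trans (s≤s y≤1+a) (subst (2 + a ≤_) (+-comm P a) (+-monoˡ-≤ a 2≤P)) ,
  subst (2 + a ≤_) (+-comm P y) (+-mono-≤ 2≤P a≤y)

adjacent-onEdge⇒near : ∀ {a y z} → y ≤ suc z → z ≤ suc y → OnEdge z a → Near 3 a y
adjacent-onEdge⇒near {a} {y} y≤1+z z≤1+y (a≤z , z≤1+a) =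
  subst (suc y ≤_) (+-comm 3 a) (s≤s (≤-trans y≤1+z (s≤s z≤1+a))) ,
  subst (2 + a ≤_) (+-comm 3 y) (s≤s (s≤s (≤-trans a≤z z≤1+y)))

near-across : ∀ {P a y z} → y + 3 ≤ z + P → z + 3 ≤ y + P → Near 3 a z → Near P a y
near-across {P} {a} {y} {z} y+3≤z+P z+3≤y+P (1+z≤a+3 , 2+a≤z+3) =
  +-cancelʳ-≤ (z + 3) (suc y) (a + P)
    (subst₂ _≤_ (lhs y z) (rhs z P a) (+-mono-≤ y+3≤z+P 1+z≤a+3)) ,
  ≤-trans 2+a≤z+3 z+3≤y+P
  where
  lhs : ∀ y z → y + 3 + suc z ≡ suc y + (z + 3)
  lhs = solve-∀
  rhs : ∀ z P a → z + P + (a + 3) ≡ a + P + (z + 3)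
  rhs = solve-∀

near-near⇒≤ : ∀ {P a y z} → Near P a y → Near P a z → y + 3 ≤ z + 2 * P
near-near⇒≤ {P} {a} {y} {z} (1+y≤a+P , _) (_ , 2+a≤z+P) =
  +-cancelʳ-≤ a (y + 3) (z + 2 * P)
    (subst₂ _≤_ (lhs y a) (rhs a P z) (+-mono-≤ 1+y≤a+P 2+a≤z+P))
  where
  lhs : ∀ y a → suc y + (2 + a) ≡ y + 3 + a
  lhs = solve-∀
  rhs : ∀ a P z → a + P + (z + P) ≡ z + 2 * P + a
  rhs = solve-∀

2≤2^1+n : ∀ n → 2 ≤ 2 ^ suc n
2≤2^1+n n = *-monoʳ-≤ 2 (m^n>0 2 n)

≤+⇒≤+2* : ∀ {y z P} → y ≤ z + P → y ≤ z + 2 * P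
≤+⇒≤+2* {z = z} {P} y≤z+P = ≤-trans y≤z+P (+-monoʳ-≤ z (m≤m+n P (P + 0)))

module LinkedWalks (H : Hypergraph) (EF : EliminationForest H) {n} (hom : HomToPath H n) where
  open EliminationForest EF
  open ForestOrder forest
  open TopNode H EF
  open HomToPath hom

  Vertex : Set
  Vertex = Fin (nV H)

  x : Vertex → ℕ
  x v = toℕ (hV v)

  a : Node → ℕ
  a t = toℕ (hE (Γ t))

  member-onEdge : ∀ {e v} → v ∈ β H e → OnEdge (x v) (toℕ (hE e))
  member-onEdge {e} {v} v∈e with image⊆ e v v∈e
  ... | inj₁ hv≡e rewrite hv≡e | toℕ-inject₁ (hE e) = ≤-refl , n≤1+n _
  ... | inj₂ hv≡e rewrite hv≡e = n≤1+n _ , ≤-refl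

  τ-onEdge : ∀ {v t} → τ v ≡ t → OnEdge (x v) (a t)
  τ-onEdge {v} refl = member-onEdge (τ-mem v)

  Linked : Vertex → Vertex → Set
  Linked u w = Comparable (τ u) (τ w) × x u ≤ suc (x w) × x w ≤ suc (x u)

  linked-sym : ∀ {u w} → Linked u w → Linked w u
  linked-sym (inj₁ p , u≤ , w≤) = inj₂ p , w≤ , u≤
  linked-sym (inj₂ p , u≤ , w≤) = inj₁ p , w≤ , u≤

  co-member-linked : ∀ {e u w} → u ∈ β H e → w ∈ β H e → Linked u w
  co-member-linked u∈e w∈e =
    τ-comparable u∈e w∈e , adjacent u∈e w∈e , adjacent w∈e u∈e
    where
    adjacent : ∀ {e u w} → u ∈ β H e → w ∈ β H e → x u ≤ suc (x w)
    adjacent u∈e w∈e = ≤-trans (proj₂ (member-onEdge u∈e)) (s≤s (proj₁ (member-onEdge w∈e)))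

  incidence-walk⇒linked-walk : ∀ {u y w} → Star (IncAdj H) (inj₁ u) y → y ≡ inj₁ w → Star Linked u w
  incidence-walk⇒linked-walk ε                        refl = ε
  incidence-walk⇒linked-walk (ve _ ◅ ε)               ()
  incidence-walk⇒linked-walk (ve u∈e ◅ ev w∈e ◅ walk) end =
    co-member-linked u∈e w∈e ◅ incidence-walk⇒linked-walk walk end

  Below : Node → Vertex → Set
  Below t v = t ≼ τ v

  LinkedBelow : Node → Vertex → Vertex → Set
  LinkedBelow t u w = Linked u w × Below t u × Below t w

  linkedBelow-sym : ∀ {t u w} → LinkedBelow t u w → LinkedBelow t w u
  linkedBelow-sym (link , below-u , below-w) = linked-sym link , below-w , below-u

  below-end : ∀ {t u w} → Below t u → Star (LinkedBelow t) u w → Below t w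
  below-end below-u ε                          = below-u
  below-end _       ((_ , _ , below-v) ◅ walk) = below-end below-v walk

  linked-walk-below-root : ∀ {r u w} → IsRoot r → Below r u → Star Linked u w → Star (LinkedBelow r) u w
  linked-walk-below-root root below-u ε = ε
  linked-walk-below-root root below-u (link ◅ walk) =
    (link , below-u , below-v) ◅ linked-walk-below-root root below-v walk
    where below-v = comparable-below-root root below-u (proj₁ link)

  InChildSubtree : Node → Vertex → Vertex → Set
  InChildSubtree t u w = ∃ λ c → parent forest c ≡ just t × Below c u × Star (LinkedBelow c) u w

  ReachesTop : Node → Vertex → Set
  ReachesTop t u = τ u ≡ t ⊎ ∃ λ c → ∃₂ λ b z →
    parent forest c ≡ just t × Below c u × Star (LinkedBelow c) u b × Linked b z × τ z ≡ t

  walk-split : ∀ {t u w} → Below t u → Star (LinkedBelow t) u w → InChildSubtree t u w ⊎ ReachesTop t u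
  walk-split {t} {u} below-u walk with τ u Fin.≟ t
  ... | yes τu≡t = inj₂ (inj₁ τu≡t)
  ... | no τu≢t = split walk
    where
    into-child : ∀ {c v} → parent forest c ≡ just t → Linked u v → Below c v → Below c u
    into-child pc link = comparable-below-child pc below-u τu≢t (proj₁ link)

    extend : ∀ {v w} → Linked u v → InChildSubtree t v w ⊎ ReachesTop t v →
             InChildSubtree t u w ⊎ ReachesTop t u
    extend link (inj₁ (c , pc , below-c , walk)) =
      let below-c-u = into-child pc link below-c
      in inj₁ (c , pc , below-c-u , (link , below-c-u , below-c) ◅ walk)
    extend link (inj₂ (inj₁ τv≡t)) with child-toward below-u τu≢t
    ... | c , pc , below-c-u = inj₂ (inj₂ (c , u , _ , pc , below-c-u , ε , link , τv≡t))
    extend link (inj₂ (inj₂ (c , b , z , pc , below-c , walk , link-bz , τz≡t))) =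
      let below-c-u = into-child pc link below-c
      in inj₂ (inj₂ (c , b , z , pc , below-c-u , (link , below-c-u , below-c) ◅ walk , link-bz , τz≡t))

    split : ∀ {w} → Star (LinkedBelow t) u w → InChildSubtree t u w ⊎ ReachesTop t u
    split ε with child-toward below-u τu≢t
    ... | c , pc , below-c = inj₁ (c , pc , below-c , ε)
    split ((link , _ , below-v) ◅ walk) = extend link (walk-split below-v walk)

  Spread : Node → ℕ → Set
  Spread t P = ∀ {u w} → Below t u → Star (LinkedBelow t) u w → x u + 3 ≤ x w + P

  module _ {k} (height≤k : HeightAtMost forest k) where

    spread : ∀ h {t D} → HasDepth forest t D → k < D + h → Spread t (2 ^ suc h)
    spread zero {t} {D} depth k<D+0 _ _ =
      ⊥-elim (<⇒≱ (subst (k <_) (+-identityʳ D) k<D+0) (height≤k t D depth))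
    spread (suc h) {t} {D} depth k<D+1+h {u} {w} below-u walk =
      combine (walk-split below-u walk) (walk-split (below-end below-u walk) (reverse linkedBelow-sym walk))
      where
      P = 2 ^ suc h

      spread-child : ∀ {c} → parent forest c ≡ just t → Spread c P
      spread-child pc = spread h (dep-step pc depth) (subst (k <_) (+-suc D h) k<D+1+h)

      near-top : ∀ {v} → ReachesTop t v → Near P (a t) (x v)
      near-top (inj₁ τv≡t) = onEdge⇒near (2≤2^1+n h) (τ-onEdge τv≡t)
      near-top (inj₂ (c , b , z , pc , below-v , walk , (_ , b≤1+z , z≤1+b) , τz≡t)) =
        near-across (spread-child pc below-v walk)
                    (spread-child pc (below-end below-v walk) (reverse linkedBelow-sym walk))
                    (adjacent-onEdge⇒near b≤1+z z≤1+b (τ-onEdge τz≡t))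

      combine : InChildSubtree t u w ⊎ ReachesTop t u → InChildSubtree t w u ⊎ ReachesTop t w →
                x u + 3 ≤ x w + 2 * P
      combine (inj₁ (c , pc , below-c , walk′)) _ = ≤+⇒≤+2* {z = x w} {P} (spread-child pc below-c walk′)
      combine (inj₂ _) (inj₁ (c , pc , below-c , walk′)) =
        ≤+⇒≤+2* {z = x w} {P} (spread-child pc (below-end below-c walk′) (reverse linkedBelow-sym walk′))
      combine (inj₂ top-u) (inj₂ top-w) = near-near⇒≤ (near-top top-u) (near-top top-w)

corollaryB3 : (k : ℕ) → 1 ≤ k → (H : Hypergraph) → Connected H →
    HypertreeDepthAtMost H k → (n : ℕ) → 2 ^ (k + 1) ≤ n →
    ¬ (Σ (HomToPath H n) λ h →
         Surjective _≡_ _≡_ (HomToPath.hV h) × Surjective _≡_ _≡_ (HomToPath.hE h))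
corollaryB3 k _ H connected (EF , height≤k) n 2^k+1≤n (hom , hV-onto , _) =
  <⇒≱ n<2^k+1 2^k+1≤n
  where
  open EliminationForest EF
  open ForestOrder forest
  open TopNode H EF
  open LinkedWalks H EF hom

  top = proj₁ (hV-onto (fromℕ n))
  bottom = proj₁ (hV-onto fzero)

  x-top : x top ≡ n
  x-top = trans (cong toℕ (proj₂ (hV-onto (fromℕ n)) refl)) (toℕ-fromℕ n)

  x-bottom : x bottom ≡ 0
  x-bottom = cong toℕ (proj₂ (hV-onto fzero) refl)

  root-data = ∃-root-≼ (τ top)
  r = proj₁ root-data
  r-root = proj₁ (proj₂ root-data)
  below-r = proj₂ (proj₂ root-data)

  bound : x top + 3 ≤ x bottom + 2 ^ suc k
  bound = spread height≤k k (dep-root r-root) (n<1+n k) below-r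
            (linked-walk-below-root r-root below-r
              (incidence-walk⇒linked-walk (connected (inj₁ top) (inj₁ bottom)) refl))

  n<2^k+1 : n < 2 ^ (k + 1)
  n<2^k+1 = subst (n <_) (cong (2 ^_) (+-comm 1 k))
              (<-≤-trans (m<m+n n z<s) (subst₂ (λ y z → y + 3 ≤ z + 2 ^ suc k) x-top x-bottom bound))
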